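{- Let $\sigma,\tau\in S_n$. Then $T_L(\sigma\vee_R\tau)\subseteq T\cap V_{S_n}(\sigma,\tau)$. Moreover, for every $t\in T_L(\sigma\vee_R\tau)$ there is a palindromic $(\sigma,\tau)$-Bruhat path from $e$ to $t$.
   Context: $S_n$ is the symmetric group on $[n]=\{1,\dots,n\}$, viewed as the Coxeter group of type $A_{n-1}$ with simple reflections $S=\{(i\ i+1)\mid i\in[n-1]\}$; its reflections are the transpositions $T=\{(i\ j)\mid 1\leq i<j\leq n\}$. Permutations compose as functions (right to left). The length $\ell(\sigma)$ equals the number of inversions $|\{(i,j)\mid i<j,\ \sigma(i)>\sigma(j)\}|$. Right weak order: $\sigma\leq_R\tau$ iff a reduced expression of $\sigma$ is a prefix of a reduced expression of $\tau$; $\sigma\vee_R\tau$ is the join in this lattice. $T_L(w)=\{t\in T\mid \ell(tw)<\ell(w)\}$. Bruhat graph: vertices $S_n$, directed edge $x\xrightarrow{t}y$ labeled $t\in T$ iff $y=tx$ and $\ell(x)<\ell(y)$. A $(\sigma,\tau)$-Bruhat path is a directed path in the Bruhat graph starting at $e$ whose edge labels all lie in $T_L(\sigma)\cup T_L(\tau)$; $V_{S_n}(\sigma,\tau)$ is the set of all vertices of all $(\sigma,\tau)$-Bruhat paths. A Bruhat path is palindromic if its sequence of edge labels is a palindrome. -}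

module Defs where

open import Data.Nat as ℕ using (ℕ; zero; suc; _<_)
open import Data.Fin as Fin using (Fin; toℕ; fromℕ<; _≟_)
open import Data.Fin.Properties using () renaming (_<?_ to _<ᶠ?_)
open import Data.Vec using (Vec; lookup; tabulate; allFin)
open import Data.List as List using (List; []; _∷_; _++_; map; reverse; length)
open import Data.Nat.ListAction using (sum)
open import Data.List.Membership.Propositional using (_∈_)
open import Data.Bool using (Bool; true; false; if_then_else_; _∧_)
open import Data.Product using (Σ; _×_; _,_; ∃; ∃-syntax; Σ-syntax)
open import Data.Sum using (_⊎_)
open import Relation.Nullary.Decidable using (⌊_⌋)
open import Relation.Binary.PropositionalEquality using (_≡_)

-- A permutation σ of [n] (0-indexed as Fin n) is represented by its
-- one-line notation: the vector whose i-th entry is σ(i).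
Perm : ℕ → Set
Perm n = Vec (Fin n) n

IsPerm : ∀ {n} → Perm n → Set
IsPerm {n} σ = ∀ (i j : Fin n) → lookup σ i ≡ lookup σ j → i ≡ j

e : ∀ {n} → Perm n
e {n} = allFin n

_∘ₚ_ : ∀ {n} → Perm n → Perm n → Perm n
σ ∘ₚ τ = tabulate (λ i → lookup σ (lookup τ i))

swap : ∀ {n} → Fin n → Fin n → Fin n → Fin n
swap a b x = if ⌊ x ≟ a ⌋ then b else (if ⌊ x ≟ b ⌋ then a else x)

transp : ∀ {n} → Fin n → Fin n → Perm n
transp a b = tabulate (swap a b)

indic : Bool → ℕ
indic true  = 1
indic false = 0

ℓ : ∀ {n} → Perm n → ℕ
ℓ {n} σ = sum (map (λ i → sum (map (λ j →
            indic (⌊ i <ᶠ? j ⌋ ∧ ⌊ lookup σ j <ᶠ? lookup σ i ⌋))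
            (List.allFin n))) (List.allFin n))

-- simple reflections s_i = (i i+1), indexed (0-based) by i with i+1 < n
SimpleIx : ℕ → Set
SimpleIx n = Σ ℕ (λ i → suc i < n)

simple : ∀ {n} → SimpleIx n → Perm n
simple (i , p) = transp (fromℕ< (ℕ.<-trans (ℕ.n<1+n i) p)) (fromℕ< p)
  where import Data.Nat.Properties as ℕ

Word : ℕ → Set
Word n = List (SimpleIx n)

prod : ∀ {n} → Word n → Perm n
prod []       = e
prod (s ∷ w) = simple s ∘ₚ prod w

IsReduced : ∀ {n} → Word n → Perm n → Set
IsReduced w σ = (prod w ≡ σ) × (length w ≡ ℓ σ)

_≤R_ : ∀ {n} → Perm n → Perm n → Set
_≤R_ {n} σ τ = Σ[ a ∈ Word n ] Σ[ b ∈ Word n ] (IsReduced {n} a σ × IsReduced (a ++ b) τ)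

IsJoinR : ∀ {n} → Perm n → Perm n → Perm n → Set
IsJoinR {n} σ τ ρ =
  IsPerm ρ × (σ ≤R ρ) × (τ ≤R ρ) ×
  (∀ (π : Perm n) → IsPerm π → σ ≤R π → τ ≤R π → ρ ≤R π)

-- reflections: transpositions (i j) with i < j, encoded by the pair (i , j)
Label : ℕ → Set
Label n = Fin n × Fin n

IsRefl : ∀ {n} → Label n → Set
IsRefl (i , j) = i Fin.< j

toPerm : ∀ {n} → Label n → Perm n
toPerm (i , j) = transp i j

InTL : ∀ {n} → Label n → Perm n → Set
InTL t w = IsRefl t × (ℓ (toPerm t ∘ₚ w) < ℓ w)

-- directed paths in the Bruhat graph with edge labels in T_L(σ) ∪ T_L(τ):
-- BPath σ τ x ts y : a path from x to y whose label sequence is ts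
data BPath {n} (σ τ : Perm n) : Perm n → List (Label n) → Perm n → Set where
  done : ∀ {x} → BPath σ τ x [] x
  step : ∀ {x ts y} (t : Label n) → IsRefl t → (InTL t σ ⊎ InTL t τ) →
         ℓ x < ℓ (toPerm t ∘ₚ x) →
         BPath σ τ (toPerm t ∘ₚ x) ts y → BPath σ τ x (t ∷ ts) y

vertices : ∀ {n} {σ τ x y : Perm n} {ts : List (Label n)} → BPath {n} σ τ x ts y → List (Perm n)
vertices {x = x} done = x ∷ []
vertices {x = x} (step t _ _ _ p) = x ∷ vertices p

InV : ∀ {n} → Perm n → Perm n → Perm n → Set
InV {n} σ τ v = Σ[ y ∈ Perm n ] Σ[ ts ∈ List (Label n) ] Σ (BPath σ τ e ts y) (λ p → v ∈ vertices p)

Palindrome : ∀ {A : Set} → List A → Set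
Palindrome xs = reverse xs ≡ xs

-- Read T_L(w) as the set of value pairs p < q that w lists in the order q … p. If (a c) lies in
-- T_L(σ ∨_R τ), there is a chain a = b₀ < b₁ < ⋯ < b_k = c whose links (bᵢ bᵢ₊₁) lie in
-- T_L(σ) ∪ T_L(τ). Otherwise list first the values that cannot reach c along such links and then
-- those that can, each group in decreasing order: the resulting π has all inversions of σ and τ,
-- hence lies above both in the weak order, yet a precedes c in π, so (a c) ∉ T_L(π) ⊇ T_L(σ ∨_R τ).
-- Along a chain, (a c) = (a b₁)(b₁ c)(a b₁) unfolds recursively into a palindromic word of links,
-- and every step raises the length because it exchanges two values that stand in increasing order.

{-# OPTIONS --safe #-}
module Submission where

open import Defs
open import Data.Nat using (ℕ)
open import Data.Product using (Σ; _×_; Σ-syntax)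
open import Data.List using (List)

open import Data.Nat as ℕ using (zero; suc; _+_; _∸_; z≤n; s≤s)
import Data.Nat.Properties as ℕ
open import Algebra.Properties.CommutativeMonoid.Sum ℕ.+-0-commutativeMonoid
  using (sum; sum-cong-≗; sum-permute; sum-replicate-zero)
open import Algebra.Properties.CommutativeSemigroup ℕ.+-commutativeSemigroup using (x∙yz≈y∙xz)
open import Data.Bool using (true; false; _∧_)
open import Data.Empty using (⊥-elim)
open import Data.Fin as Fin using (Fin; toℕ; fromℕ<; punchOut; _<_; _≤_; _>_)
open import Data.Fin.Induction using (>-wellFounded)
open import Data.Fin.Patterns using (0F; 1F)
import Data.Fin.Permutation as Permutation
import Data.Fin.Permutation.Components as PC
open import Data.Fin.Properties
  using ( _≟_; _<?_; toℕ-injective; toℕ<n; toℕ-fromℕ<; <-cmp; <-asym; <-irrefl; <-trans; ≤-refl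
        ; ≤∧≢⇒<; <⇒≢; any?; punchOut-injective; <⇒notInjective)
open import Data.List as List using ([]; _∷_; _++_; [_]; _∷ʳ_; length; reverse)
open import Data.List.Membership.Propositional using (_∈_)
open import Data.List.Properties using (++-identityʳ; ++-assoc; length-++; unfold-reverse; reverse-++)
open import Data.List.Relation.Unary.Any using (here; there)
open import Data.Nat.Induction using (<-wellFounded)
open import Data.Nat.ListAction using () renaming (sum to sumᴸ)
open import Data.Product using (∃; ∃₂; _,_; proj₁; proj₂)
open import Data.Sum using (_⊎_; inj₁; inj₂)
open import Data.Vec using (lookup; tabulate)
open import Data.Vec.Properties using (lookup∘tabulate; tabulate∘lookup; tabulate-cong; lookup-allFin)
open import Function using (_∘_; id; Injective; mk⇔)
open import Induction.WellFounded using (Acc; acc)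
open import Relation.Binary using (Tri; tri<; tri≈; tri>)
open import Relation.Binary.Construct.Closure.Transitive using (TransClosure; _∷_) renaming ([_] to [_]⁺)
open import Relation.Binary.PropositionalEquality
  using (_≡_; _≢_; _≗_; refl; sym; trans; cong; cong₂; subst; subst₂; module ≡-Reasoning)
open import Relation.Nullary using (¬_; Dec; yes; no; contradiction)
open import Relation.Nullary.Decidable
  using (⌊_⌋; isYes≗does; does-⇔; dec-true; dec-false; map′; _×-dec_; _⊎-dec_)

private
  variable
    m k : ℕ

-- Transpositions of Fin n

module _ {n : ℕ} where

  data SwapCase (a b x : Fin n) : Set where
    first   : x ≡ a → SwapCase a b x
    second  : x ≢ a → x ≡ b → SwapCase a b x
    neither : x ≢ a → x ≢ b → SwapCase a b x

  swapCase : (a b x : Fin n) → SwapCase a b x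
  swapCase a b x with x ≟ a | x ≟ b
  ... | yes x≡a | _       = first x≡a
  ... | no x≢a  | yes x≡b = second x≢a x≡b
  ... | no x≢a  | no x≢b  = neither x≢a x≢b

  swap-first : (a b : Fin n) → swap a b a ≡ b
  swap-first a b with a ≟ a
  ... | yes _   = refl
  ... | no a≢a = contradiction refl a≢a

  swap-second : (a b : Fin n) → swap a b b ≡ a
  swap-second a b with b ≟ a | b ≟ b
  ... | yes b≡a | _       = b≡a
  ... | no _    | yes _   = refl
  ... | no _    | no b≢b  = contradiction refl b≢b

  swap-neither : (a b x : Fin n) → x ≢ a → x ≢ b → swap a b x ≡ x
  swap-neither a b x x≢a x≢b with x ≟ a | x ≟ b
  ... | yes x≡a | _       = contradiction x≡a x≢a
  ... | no _    | yes x≡b = contradiction x≡b x≢b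
  ... | no _    | no _    = refl

  swap-involutive : (a b x : Fin n) → swap a b (swap a b x) ≡ x
  swap-involutive a b x with swapCase a b x
  ... | first refl       = trans (cong (swap a b) (swap-first a b)) (swap-second a b)
  ... | second _ refl    = trans (cong (swap a b) (swap-second a b)) (swap-first a b)
  ... | neither x≢a x≢b = trans (cong (swap a b) (swap-neither a b x x≢a x≢b)) (swap-neither a b x x≢a x≢b)

  swap-injective : (a b : Fin n) → Injective _≡_ _≡_ (swap a b)
  swap-injective a b {x} {y} eq = begin
    x                       ≡⟨ swap-involutive a b x ⟨
    swap a b (swap a b x)   ≡⟨ cong (swap a b) eq ⟩
    swap a b (swap a b y)   ≡⟨ swap-involutive a b y ⟩
    y                       ∎
    where open ≡-Reasoning

  swap-conjugate : (a r b : Fin n) → a ≢ r → r ≢ b → a ≢ b →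
                   swap a r ∘ swap r b ∘ swap a r ≗ swap a b
  swap-conjugate a r b a≢r r≢b a≢b x with swapCase a b x | swapCase a r x
  ... | first refl | _ = begin
    swap a r (swap r b (swap a r a)) ≡⟨ cong (swap a r ∘ swap r b) (swap-first a r) ⟩
    swap a r (swap r b r)            ≡⟨ cong (swap a r) (swap-first r b) ⟩
    swap a r b                       ≡⟨ swap-neither a r b (a≢b ∘ sym) (r≢b ∘ sym) ⟩
    b                                ≡⟨ swap-first a b ⟨
    swap a b a                       ∎
    where open ≡-Reasoning
  ... | second _ refl | _ = begin
    swap a r (swap r b (swap a r b)) ≡⟨ cong (swap a r ∘ swap r b) (swap-neither a r b (a≢b ∘ sym) (r≢b ∘ sym)) ⟩
    swap a r (swap r b b)            ≡⟨ cong (swap a r) (swap-second r b) ⟩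
    swap a r r                       ≡⟨ swap-second a r ⟩
    a                                ≡⟨ swap-second a b ⟨
    swap a b b                       ∎
    where open ≡-Reasoning
  ... | neither x≢a _ | first x≡a = contradiction x≡a x≢a
  ... | neither x≢a x≢b | second _ refl = begin
    swap a r (swap r b (swap a r r)) ≡⟨ cong (swap a r ∘ swap r b) (swap-second a r) ⟩
    swap a r (swap r b a)            ≡⟨ cong (swap a r) (swap-neither r b a a≢r a≢b) ⟩
    swap a r a                       ≡⟨ swap-first a r ⟩
    x                                ≡⟨ swap-neither a b x x≢a x≢b ⟨
    swap a b x                       ∎
    where open ≡-Reasoning
  ... | neither x≢a x≢b | neither _ x≢r = begin
    swap a r (swap r b (swap a r x)) ≡⟨ cong (swap a r ∘ swap r b) (swap-neither a r x x≢a x≢r) ⟩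
    swap a r (swap r b x)            ≡⟨ cong (swap a r) (swap-neither r b x x≢r x≢b) ⟩
    swap a r x                       ≡⟨ swap-neither a r x x≢a x≢r ⟩
    x                                ≡⟨ swap-neither a b x x≢a x≢b ⟨
    swap a b x                       ∎
    where open ≡-Reasoning

swap-suc : ∀ {n} (a b x : Fin n) → swap (Fin.suc a) (Fin.suc b) (Fin.suc x) ≡ Fin.suc (swap a b x)
swap-suc a b x with x ≟ a
... | yes _ = refl
... | no _ with x ≟ b
...   | yes _ = refl
...   | no _  = refl

swap≗transpose : ∀ {n} (a b : Fin n) → swap a b ≗ PC.transpose a b
swap≗transpose a b x with x ≟ a
... | yes _ = refl
... | no _ with x ≟ b
...   | yes _ = refl
...   | no _ = refl

Adjacent : Fin m → Fin m → Set
Adjacent P Q = toℕ Q ≡ suc (toℕ P)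

Adjacent⇒< : {P Q : Fin m} → Adjacent P Q → P < Q
Adjacent⇒< adj = ℕ.≤-reflexive (sym adj)

swap-adjacent-<-preserved : {P Q i j : Fin m} → Adjacent P Q → i < j → ¬ (i ≡ P × j ≡ Q) →
                            swap P Q i < swap P Q j
swap-adjacent-<-preserved {P = P} {Q = Q} {i = i} {j = j} adj i<j not-PQ with swapCase P Q i | swapCase P Q j
... | first refl     | first refl     = contradiction i<j (<-irrefl refl)
... | first refl     | second _ refl  = contradiction (refl , refl) not-PQ
... | first refl     | neither _ j≢Q  = subst₂ _<_ (sym (swap-first P Q)) (sym (swap-neither P Q j (<⇒≢ i<j ∘ sym) j≢Q))
                                          (≤∧≢⇒< (subst (ℕ._≤ toℕ j) (sym adj) i<j) (j≢Q ∘ sym))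
... | second _ refl  | first refl     = contradiction i<j (<-asym (Adjacent⇒< adj))
... | second _ refl  | second _ refl  = contradiction i<j (<-irrefl refl)
... | second _ refl  | neither j≢P j≢Q = subst₂ _<_ (sym (swap-second P Q)) (sym (swap-neither P Q j j≢P j≢Q))
                                          (<-trans (Adjacent⇒< adj) i<j)
... | neither i≢P i≢Q | first refl    = subst₂ _<_ (sym (swap-neither P Q i i≢P i≢Q)) (sym (swap-first P Q))
                                          (<-trans i<j (Adjacent⇒< adj))
... | neither i≢P i≢Q | second _ refl = subst₂ _<_ (sym (swap-neither P Q i i≢P i≢Q)) (sym (swap-second P Q))
                                          (≤∧≢⇒< (ℕ.≤-pred (subst (toℕ i ℕ.<_) adj i<j)) i≢P)
... | neither i≢P i≢Q | neither j≢P j≢Q = subst₂ _<_ (sym (swap-neither P Q i i≢P i≢Q))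
                                             (sym (swap-neither P Q j j≢P j≢Q)) i<j

-- Inversion counts

⌊suc<?suc⌋ : (i j : Fin m) → ⌊ Fin.suc i <? Fin.suc j ⌋ ≡ ⌊ i <? j ⌋
⌊suc<?suc⌋ i j = trans (isYes≗does _)
  (trans (does-⇔ (mk⇔ ℕ.≤-pred s≤s) (Fin.suc i <? Fin.suc j) (i <? j)) (sym (isYes≗does _)))

⌊⌋-true : {A : Set} (a? : Dec A) → A → ⌊ a? ⌋ ≡ true
⌊⌋-true a? a = trans (isYes≗does a?) (dec-true a? a)

⌊⌋-false : {A : Set} (a? : Dec A) → ¬ A → ⌊ a? ⌋ ≡ false
⌊⌋-false a? ¬a = trans (isYes≗does a?) (dec-false a? ¬a)

sum-swap : ∀ (h : Fin m → ℕ) (a b : Fin m) → sum (h ∘ swap a b) ≡ sum h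
sum-swap h a b = sym (trans (sum-permute h (Permutation.transpose a b))
                            (sum-cong-≗ (cong h ∘ sym ∘ swap≗transpose a b)))

sum-mono-≤ : {f g : Fin m → ℕ} → (∀ i → f i ℕ.≤ g i) → sum f ℕ.≤ sum g
sum-mono-≤ {zero}  f≤g = z≤n
sum-mono-≤ {suc m} f≤g = ℕ.+-mono-≤ (f≤g Fin.zero) (sum-mono-≤ (f≤g ∘ Fin.suc))

sum-mono-< : {f g : Fin m → ℕ} → (∀ i → f i ℕ.≤ g i) → ∀ j → f j ℕ.< g j → sum f ℕ.< sum g
sum-mono-< {suc m} f≤g Fin.zero    fj<gj = ℕ.+-mono-<-≤ fj<gj (sum-mono-≤ (f≤g ∘ Fin.suc))
sum-mono-< {suc m} f≤g (Fin.suc j) fj<gj = ℕ.+-mono-≤-< (f≤g Fin.zero) (sum-mono-< (f≤g ∘ Fin.suc) j fj<gj)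

sum-ones : ∀ m → sum {m} (λ _ → 1) ≡ m
sum-ones zero    = refl
sum-ones (suc m) = cong suc (sum-ones m)

indic≤1 : ∀ b → indic b ℕ.≤ 1
indic≤1 true  = s≤s z≤n
indic≤1 false = z≤n

#below : Fin k → (Fin m → Fin k) → ℕ
#below v f = sum (λ j → indic ⌊ f j <? v ⌋)

inversions : (Fin m → Fin k) → ℕ
inversions {zero}  f = 0
inversions {suc m} f = #below (f Fin.zero) (f ∘ Fin.suc) + inversions (f ∘ Fin.suc)

sumᴸ-map-tabulate : ∀ {A : Set} (g : Fin m → A) (h : A → ℕ) →
                    sumᴸ (List.map h (List.tabulate g)) ≡ sum (h ∘ g)
sumᴸ-map-tabulate {zero}  g h = refl
sumᴸ-map-tabulate {suc m} g h = cong (h (g Fin.zero) +_) (sumᴸ-map-tabulate (g ∘ Fin.suc) h)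

inversionPairs : (Fin m → Fin k) → ℕ
inversionPairs f = sum λ i → sum λ j → indic (⌊ i <? j ⌋ ∧ ⌊ f j <? f i ⌋)

inversionPairs≡inversions : (f : Fin m → Fin k) → inversionPairs f ≡ inversions f
inversionPairs≡inversions {zero}  f = refl
inversionPairs≡inversions {suc m} f = cong (#below (f Fin.zero) (f ∘ Fin.suc) +_) (begin
  sum {m} (λ i → sum {m} λ j → indic (⌊ Fin.suc i <? Fin.suc j ⌋ ∧ ⌊ f (Fin.suc j) <? f (Fin.suc i) ⌋))
    ≡⟨ sum-cong-≗ (λ i → sum-cong-≗ λ j →
         cong (λ b → indic (b ∧ ⌊ f (Fin.suc j) <? f (Fin.suc i) ⌋)) (⌊suc<?suc⌋ i j)) ⟩
  inversionPairs (f ∘ Fin.suc)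
    ≡⟨ inversionPairs≡inversions (f ∘ Fin.suc) ⟩
  inversions (f ∘ Fin.suc) ∎)
  where open ≡-Reasoning

ℓ≡inversions : ∀ {n} (x : Perm n) → ℓ x ≡ inversions (lookup x)
ℓ≡inversions {n} x = begin
  ℓ x                       ≡⟨ sumᴸ-map-tabulate id row ⟩
  sum row                   ≡⟨ sum-cong-≗ (λ i → sumᴸ-map-tabulate id (inverted i)) ⟩
  inversionPairs (lookup x) ≡⟨ inversionPairs≡inversions (lookup x) ⟩
  inversions (lookup x)     ∎
  where
  open ≡-Reasoning
  inverted : Fin n → Fin n → ℕ
  inverted i j = indic (⌊ i <? j ⌋ ∧ ⌊ lookup x j <? lookup x i ⌋)
  row : Fin n → ℕ
  row i = sumᴸ (List.map (inverted i) (List.allFin n))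

#below-cong : (v : Fin k) {f g : Fin m → Fin k} → f ≗ g → #below v f ≡ #below v g
#below-cong v f≗g = sum-cong-≗ (λ j → cong (λ w → indic ⌊ w <? v ⌋) (f≗g j))

inversions-cong : {f g : Fin m → Fin k} → f ≗ g → inversions f ≡ inversions g
inversions-cong {zero}  f≗g = refl
inversions-cong {suc m} {f = f} {g = g} f≗g =
  cong₂ _+_ (trans (cong (λ v → #below v (f ∘ Fin.suc)) (f≗g Fin.zero)) (#below-cong (g Fin.zero) (f≗g ∘ Fin.suc)))
            (inversions-cong (f≗g ∘ Fin.suc))

inversions-swap-ascent : (f : Fin m → Fin k) {P Q : Fin m} → Adjacent P Q → f P < f Q →
                         inversions (f ∘ swap P Q) ≡ suc (inversions f)
inversions-swap-ascent {suc (suc m)} f {Fin.zero} {Fin.suc Fin.zero} refl f0<f1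
  with f Fin.zero <? f (Fin.suc Fin.zero) | f (Fin.suc Fin.zero) <? f Fin.zero
... | no f0≮f1 | _       = contradiction f0<f1 f0≮f1
... | yes _    | yes f1<f0 = contradiction f1<f0 (<-asym f0<f1)
... | yes _    | no _    = cong suc (x∙yz≈y∙xz (#below (f 1F) (f ∘ Fin.suc ∘ Fin.suc))
                                               (#below (f 0F) (f ∘ Fin.suc ∘ Fin.suc))
                                               (inversions (f ∘ Fin.suc ∘ Fin.suc)))
inversions-swap-ascent {suc m} f {Fin.suc P} {Fin.suc Q} adj fP<fQ = begin
  #below (f Fin.zero) (f ∘ swap (Fin.suc P) (Fin.suc Q) ∘ Fin.suc)
    + inversions (f ∘ swap (Fin.suc P) (Fin.suc Q) ∘ Fin.suc)
    ≡⟨ cong₂ _+_ (#below-cong (f Fin.zero) shift) (inversions-cong shift) ⟩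
  #below (f Fin.zero) (f ∘ Fin.suc ∘ swap P Q) + inversions (f ∘ Fin.suc ∘ swap P Q)
    ≡⟨ cong₂ _+_ (sum-swap (λ j → indic ⌊ f (Fin.suc j) <? f Fin.zero ⌋) P Q)
                 (inversions-swap-ascent (f ∘ Fin.suc) (ℕ.suc-injective adj) fP<fQ) ⟩
  #below (f Fin.zero) (f ∘ Fin.suc) + suc (inversions (f ∘ Fin.suc))
    ≡⟨ ℕ.+-suc _ _ ⟩
  suc (inversions f) ∎
  where
  open ≡-Reasoning
  shift : f ∘ swap (Fin.suc P) (Fin.suc Q) ∘ Fin.suc ≗ f ∘ Fin.suc ∘ swap P Q
  shift = cong f ∘ swap-suc P Q

inversions-swap-descent : (f : Fin m → Fin k) {P Q : Fin m} → Adjacent P Q → f Q < f P →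
                          inversions f ≡ suc (inversions (f ∘ swap P Q))
inversions-swap-descent f {P} {Q} adj fQ<fP = begin
  inversions f                         ≡⟨ inversions-cong (cong f ∘ swap-involutive P Q) ⟨
  inversions (f ∘ swap P Q ∘ swap P Q) ≡⟨ inversions-swap-ascent (f ∘ swap P Q) adj ascent ⟩
  suc (inversions (f ∘ swap P Q))      ∎
  where
  open ≡-Reasoning
  ascent : f (swap P Q P) < f (swap P Q Q)
  ascent = subst₂ _<_ (sym (cong f (swap-first P Q))) (sym (cong f (swap-second P Q))) fQ<fP

-- With R = P + 1 we have (P Q) = (P R)(R Q)(P R); comparing f R with f P and f Q,
-- each outer swap by (P R) changes the count by exactly one in a direction that
-- preserves the strict increase produced by the inner swap (R Q).
inversions-swap-conjugate-< : (f : Fin m → Fin k) → Injective _≡_ _≡_ f → {P R Q : Fin m} →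
  Adjacent P R → R < Q → f P < f Q →
  inversions (f ∘ swap P R) ℕ.< inversions (f ∘ swap P R ∘ swap R Q) →
  inversions f ℕ.< inversions (f ∘ swap P Q)
inversions-swap-conjugate-< f inj {P} {R} {Q} P~R R<Q fP<fQ inner =
  byCases (<-cmp (f R) (f P)) (<-cmp (f R) (f Q))
  where
  open ℕ.≤-Reasoning
  P≢R : P ≢ R
  P≢R = <⇒≢ (Adjacent⇒< P~R)
  R≢Q : R ≢ Q
  R≢Q = <⇒≢ R<Q
  P≢Q : P ≢ Q
  P≢Q = <⇒≢ (<-trans (Adjacent⇒< P~R) R<Q)
  y z : Fin _ → Fin _
  y = f ∘ swap P R
  z = y ∘ swap R Q
  zP : z P ≡ f R
  zP = trans (cong y (swap-neither R Q P P≢R P≢Q)) (cong f (swap-first P R))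
  zR : z R ≡ f Q
  zR = trans (cong y (swap-first R Q)) (cong f (swap-neither P R Q (P≢Q ∘ sym) (R≢Q ∘ sym)))
  conjugate : inversions (z ∘ swap P R) ≡ inversions (f ∘ swap P Q)
  conjugate = inversions-cong (cong f ∘ swap-conjugate P R Q P≢R R≢Q P≢Q)
  byCases : Tri (f R < f P) (f R ≡ f P) (f P < f R) → Tri (f R < f Q) (f R ≡ f Q) (f Q < f R) →
            inversions f ℕ.< inversions (f ∘ swap P Q)
  byCases (tri≈ _ fR≡fP _) _ = contradiction (inj fR≡fP) (P≢R ∘ sym)
  byCases _ (tri≈ _ fR≡fQ _) = contradiction (inj fR≡fQ) R≢Q
  byCases (tri< fR<fP _ _) _ = begin-strict
    inversions f              ≡⟨ inversions-swap-descent f P~R fR<fP ⟩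
    suc (inversions y)        <⟨ s≤s inner ⟩
    suc (inversions z)        ≡⟨ inversions-swap-ascent z P~R (subst₂ _<_ (sym zP) (sym zR) (<-trans fR<fP fP<fQ)) ⟨
    inversions (z ∘ swap P R) ≡⟨ conjugate ⟩
    inversions (f ∘ swap P Q) ∎
  byCases (tri> _ _ fP<fR) (tri< fR<fQ _ _) = begin-strict
    inversions f              <⟨ ℕ.n<1+n _ ⟩
    suc (inversions f)        ≡⟨ inversions-swap-ascent f P~R fP<fR ⟨
    inversions y              <⟨ inner ⟩
    inversions z              <⟨ ℕ.n<1+n _ ⟩
    suc (inversions z)        ≡⟨ inversions-swap-ascent z P~R (subst₂ _<_ (sym zP) (sym zR) fR<fQ) ⟨
    inversions (z ∘ swap P R) ≡⟨ conjugate ⟩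
    inversions (f ∘ swap P Q) ∎
  byCases (tri> _ _ fP<fR) (tri> _ _ fQ<fR) = ℕ.s<s⁻¹ (begin-strict
    suc (inversions f)              ≡⟨ inversions-swap-ascent f P~R fP<fR ⟨
    inversions y                    <⟨ inner ⟩
    inversions z                    ≡⟨ inversions-swap-descent z P~R (subst₂ _<_ (sym zR) (sym zP) fQ<fR) ⟩
    suc (inversions (z ∘ swap P R)) ≡⟨ cong suc conjugate ⟩
    suc (inversions (f ∘ swap P Q)) ∎)

private
  next-index : ∀ d {P Q : Fin m} → toℕ Q ≡ suc (suc d + toℕ P) →
               Σ[ R ∈ Fin m ] Adjacent P R × toℕ Q ≡ suc (d + toℕ R)
  next-index {m} d {P} {Q} gap = R , P~R , trans gap (cong suc (trans (sym (ℕ.+-suc d (toℕ P))) (cong (d +_) (sym P~R))))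
    where
    R<m : suc (toℕ P) ℕ.< m
    R<m = ℕ.<-trans (subst (suc (toℕ P) ℕ.<_) (sym gap) (s≤s (s≤s (ℕ.m≤n+m (toℕ P) d)))) (toℕ<n Q)
    R : Fin m
    R = fromℕ< R<m
    P~R : Adjacent P R
    P~R = toℕ-fromℕ< R<m

  inversions-swap-gap : ∀ d (f : Fin m → Fin k) → Injective _≡_ _≡_ f → {P Q : Fin m} →
                        toℕ Q ≡ suc (d + toℕ P) → f P < f Q →
                        inversions f ℕ.< inversions (f ∘ swap P Q)
  inversions-swap-gap zero f _ P~Q fP<fQ = ℕ.≤-reflexive (sym (inversions-swap-ascent f P~Q fP<fQ))
  inversions-swap-gap (suc d) f inj {P} {Q} gap fP<fQ with next-index d gap
  ... | R , P~R , gapRQ = inversions-swap-conjugate-< f inj P~R R<Q fP<fQ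
          (inversions-swap-gap d (f ∘ swap P R) (swap-injective P R ∘ inj) gapRQ
            (subst₂ _<_ (sym (cong f (swap-second P R))) (sym (cong f (swap-neither P R Q (P≢Q ∘ sym) Q≢R))) fP<fQ))
    where
    R<Q : R < Q
    R<Q = subst (toℕ R ℕ.<_) (sym gapRQ) (s≤s (ℕ.m≤n+m (toℕ R) d))
    Q≢R : Q ≢ R
    Q≢R = <⇒≢ R<Q ∘ sym
    P≢Q : P ≢ Q
    P≢Q = <⇒≢ (<-trans (Adjacent⇒< P~R) R<Q)

inversions-swap-< : (f : Fin m → Fin k) → Injective _≡_ _≡_ f → {P Q : Fin m} → P < Q → f P < f Q →
                    inversions f ℕ.< inversions (f ∘ swap P Q)
inversions-swap-< f inj {P} {Q} P<Q =
  inversions-swap-gap (toℕ Q ∸ suc (toℕ P)) f inj (trans (sym (ℕ.m∸n+n≡m P<Q)) (ℕ.+-suc _ (toℕ P)))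

inversions-swap-adjacent-≤ : (f : Fin m → Fin k) {P Q : Fin m} → Adjacent P Q →
                             inversions (f ∘ swap P Q) ℕ.≤ suc (inversions f)
inversions-swap-adjacent-≤ f {P} {Q} adj with <-cmp (f P) (f Q)
... | tri< fP<fQ _ _ = ℕ.≤-reflexive (inversions-swap-ascent f adj fP<fQ)
... | tri> _ _ fQ<fP = ℕ.m<n⇒m≤1+n (ℕ.≤-reflexive (sym (inversions-swap-descent f adj fQ<fP)))
... | tri≈ _ fP≡fQ _ = ℕ.m≤n⇒m≤1+n (ℕ.≤-reflexive (inversions-cong unchanged))
  where
  unchanged : f ∘ swap P Q ≗ f
  unchanged x with swapCase P Q x
  ... | first refl       = trans (cong f (swap-first P Q)) (sym fP≡fQ)
  ... | second _ refl    = trans (cong f (swap-second P Q)) fP≡fQ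
  ... | neither x≢P x≢Q = cong f (swap-neither P Q x x≢P x≢Q)

inversions-increasing : (f : Fin m → Fin k) → (∀ {i j} → i < j → f i < f j) → inversions f ≡ 0
inversions-increasing {zero}  f _   = refl
inversions-increasing {suc m} f inc = cong₂ _+_
  (trans (sum-cong-≗ (λ j → cong indic (⌊⌋-false (f (Fin.suc j) <? f Fin.zero) (<-asym (inc (s≤s z≤n))))))
         (sum-replicate-zero m))
  (inversions-increasing (f ∘ Fin.suc) (inc ∘ s≤s))

-- Permutations

module _ {n : ℕ} where

  lookup-∘ₚ : (x y : Perm n) (i : Fin n) → lookup (x ∘ₚ y) i ≡ lookup x (lookup y i)
  lookup-∘ₚ x y = lookup∘tabulate _

  lookup-transp : (a b i : Fin n) → lookup (transp a b) i ≡ swap a b i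
  lookup-transp a b = lookup∘tabulate _

  Perm-ext : {x y : Perm n} → lookup x ≗ lookup y → x ≡ y
  Perm-ext {x} {y} eq = trans (sym (tabulate∘lookup x)) (trans (tabulate-cong eq) (tabulate∘lookup y))

  ∘ₚ-assoc : (x y z : Perm n) → (x ∘ₚ y) ∘ₚ z ≡ x ∘ₚ (y ∘ₚ z)
  ∘ₚ-assoc x y z = Perm-ext λ i → begin
    lookup ((x ∘ₚ y) ∘ₚ z) i         ≡⟨ lookup-∘ₚ (x ∘ₚ y) z i ⟩
    lookup (x ∘ₚ y) (lookup z i)     ≡⟨ lookup-∘ₚ x y (lookup z i) ⟩
    lookup x (lookup y (lookup z i)) ≡⟨ cong (lookup x) (lookup-∘ₚ y z i) ⟨
    lookup x (lookup (y ∘ₚ z) i)     ≡⟨ lookup-∘ₚ x (y ∘ₚ z) i ⟨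
    lookup (x ∘ₚ (y ∘ₚ z)) i         ∎
    where open ≡-Reasoning

  ∘ₚ-identityˡ : (x : Perm n) → e ∘ₚ x ≡ x
  ∘ₚ-identityˡ x = Perm-ext λ i → trans (lookup-∘ₚ e x i) (lookup-allFin _)

  ∘ₚ-identityʳ : (x : Perm n) → x ∘ₚ e ≡ x
  ∘ₚ-identityʳ x = Perm-ext λ i → trans (lookup-∘ₚ x e i) (cong (lookup x) (lookup-allFin i))

  transp-involutive : (a b : Fin n) (x : Perm n) → transp a b ∘ₚ (transp a b ∘ₚ x) ≡ x
  transp-involutive a b x = Perm-ext λ i → begin
    lookup (transp a b ∘ₚ (transp a b ∘ₚ x)) i  ≡⟨ lookup-∘ₚ (transp a b) (transp a b ∘ₚ x) i ⟩
    lookup (transp a b) (lookup (transp a b ∘ₚ x) i)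
                                                ≡⟨ lookup-transp a b _ ⟩
    swap a b (lookup (transp a b ∘ₚ x) i)       ≡⟨ cong (swap a b) (lookup-∘ₚ (transp a b) x i) ⟩
    swap a b (lookup (transp a b) (lookup x i)) ≡⟨ cong (swap a b) (lookup-transp a b _) ⟩
    swap a b (swap a b (lookup x i))            ≡⟨ swap-involutive a b _ ⟩
    lookup x i                                  ∎
    where open ≡-Reasoning

  IsPerm-e : IsPerm (e {n})
  IsPerm-e i j eq = trans (sym (lookup-allFin i)) (trans eq (lookup-allFin j))

  IsPerm-∘ₚ : (x y : Perm n) → IsPerm x → IsPerm y → IsPerm (x ∘ₚ y)
  IsPerm-∘ₚ x y px py i j eq = py i j (px _ _ (trans (sym (lookup-∘ₚ x y i)) (trans eq (lookup-∘ₚ x y j))))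

  IsPerm-transp : (a b : Fin n) → IsPerm (transp a b)
  IsPerm-transp a b i j eq =
    swap-injective a b (trans (sym (lookup-transp a b i)) (trans eq (lookup-transp a b j)))

  ℓ-e : ℓ (e {n}) ≡ 0
  ℓ-e = trans (ℓ≡inversions (e {n}))
    (trans (inversions-cong (lookup-allFin {n = n})) (inversions-increasing {n} id id))

  lookup-∘ₚ-transp : (x : Perm n) (a b : Fin n) → lookup (x ∘ₚ transp a b) ≗ lookup x ∘ swap a b
  lookup-∘ₚ-transp x a b k = trans (lookup-∘ₚ x (transp a b) k) (cong (lookup x) (lookup-transp a b k))

  lookup-transp∘ₚ : (x : Perm n) → IsPerm x → {P Q p q : Fin n} → lookup x P ≡ p → lookup x Q ≡ q →
                    lookup (transp p q ∘ₚ x) ≗ lookup x ∘ swap P Q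
  lookup-transp∘ₚ x px {P} {Q} {p} {q} xP xQ k = trans (lookup-∘ₚ (transp p q) x k)
    (trans (lookup-transp p q (lookup x k)) (byCase (swapCase P Q k)))
    where
    open ≡-Reasoning
    byCase : SwapCase P Q k → swap p q (lookup x k) ≡ lookup x (swap P Q k)
    byCase (first refl) = begin
      swap p q (lookup x P) ≡⟨ cong (swap p q) xP ⟩
      swap p q p            ≡⟨ swap-first p q ⟩
      q                     ≡⟨ trans (cong (lookup x) (swap-first P Q)) xQ ⟨
      lookup x (swap P Q P) ∎
    byCase (second _ refl) = begin
      swap p q (lookup x Q) ≡⟨ cong (swap p q) xQ ⟩
      swap p q q            ≡⟨ swap-second p q ⟩
      p                     ≡⟨ trans (cong (lookup x) (swap-second P Q)) xP ⟨
      lookup x (swap P Q Q) ∎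
    byCase (neither k≢P k≢Q) = begin
      swap p q (lookup x k) ≡⟨ swap-neither p q _ (k≢P ∘ px k P ∘ flip-trans xP) (k≢Q ∘ px k Q ∘ flip-trans xQ) ⟩
      lookup x k            ≡⟨ cong (lookup x) (swap-neither P Q k k≢P k≢Q) ⟨
      lookup x (swap P Q k) ∎
      where
      flip-trans : ∀ {u v w : Fin n} → u ≡ w → v ≡ w → v ≡ u
      flip-trans u≡w v≡w = trans v≡w (sym u≡w)

  ℓ-transp∘ₚ-< : (x : Perm n) → IsPerm x → {P Q p q : Fin n} → P < Q →
                 lookup x P ≡ p → lookup x Q ≡ q → p < q → ℓ x ℕ.< ℓ (transp p q ∘ₚ x)
  ℓ-transp∘ₚ-< x px {P} {Q} {p} {q} P<Q xP xQ p<q = begin-strict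
    ℓ x                                   ≡⟨ ℓ≡inversions x ⟩
    inversions (lookup x)                 <⟨ inversions-swap-< (lookup x) (px _ _) P<Q (subst₂ _<_ (sym xP) (sym xQ) p<q) ⟩
    inversions (lookup x ∘ swap P Q)      ≡⟨ inversions-cong (lookup-transp∘ₚ x px xP xQ) ⟨
    inversions (lookup (transp p q ∘ₚ x)) ≡⟨ ℓ≡inversions (transp p q ∘ₚ x) ⟨
    ℓ (transp p q ∘ₚ x)                   ∎
    where open ℕ.≤-Reasoning

  inversion⇒InTL : (x : Perm n) → IsPerm x → {i j : Fin n} → i < j → lookup x j < lookup x i →
                   InTL (lookup x j , lookup x i) x
  inversion⇒InTL x px {i} {j} i<j xj<xi = xj<xi , subst (λ w → ℓ y ℕ.< ℓ w) (transp-involutive u v x)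
    (ℓ-transp∘ₚ-< y (IsPerm-∘ₚ (transp u v) x (IsPerm-transp u v) px) i<j yi yj xj<xi)
    where
    u v : Fin n
    u = lookup x j
    v = lookup x i
    y : Perm n
    y = transp u v ∘ₚ x
    yi : lookup y i ≡ u
    yi = trans (lookup-∘ₚ (transp u v) x i) (trans (lookup-transp u v v) (swap-second u v))
    yj : lookup y j ≡ v
    yj = trans (lookup-∘ₚ (transp u v) x j) (trans (lookup-transp u v u) (swap-first u v))

-- The right weak order

module _ {n : ℕ} where

  lower upper : SimpleIx n → Fin n
  lower (i , i+1<n) = fromℕ< (ℕ.<-trans (ℕ.n<1+n i) i+1<n)
  upper (i , i+1<n) = fromℕ< i+1<n

  Adjacent-simple : (s : SimpleIx n) → Adjacent (lower s) (upper s)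
  Adjacent-simple (i , i+1<n) = trans (toℕ-fromℕ< i+1<n) (cong suc (sym (toℕ-fromℕ< _)))

  simple-at : {P Q : Fin n} → Adjacent P Q → Σ[ s ∈ SimpleIx n ] simple s ≡ transp P Q
  simple-at {P} {Q} adj = (toℕ P , subst (ℕ._< n) adj (toℕ<n Q)) ,
    cong₂ transp (toℕ-injective (toℕ-fromℕ< _)) (toℕ-injective (trans (toℕ-fromℕ< _) (sym adj)))

  ℓ-∘ₚ-simple-≤ : (x : Perm n) (s : SimpleIx n) → ℓ (x ∘ₚ simple s) ℕ.≤ suc (ℓ x)
  ℓ-∘ₚ-simple-≤ x s = begin
    ℓ (x ∘ₚ simple s)                                ≡⟨ ℓ≡inversions (x ∘ₚ simple s) ⟩
    inversions (lookup (x ∘ₚ simple s))              ≡⟨ inversions-cong (lookup-∘ₚ-transp x (lower s) (upper s)) ⟩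
    inversions (lookup x ∘ swap (lower s) (upper s)) ≤⟨ inversions-swap-adjacent-≤ (lookup x) (Adjacent-simple s) ⟩
    suc (inversions (lookup x))                      ≡⟨ cong suc (ℓ≡inversions x) ⟨
    suc (ℓ x)                                        ∎
    where open ℕ.≤-Reasoning

  prod-++ : (a b : Word n) → prod (a ++ b) ≡ prod a ∘ₚ prod b
  prod-++ []      b = sym (∘ₚ-identityˡ (prod b))
  prod-++ (s ∷ a) b = trans (cong (simple s ∘ₚ_) (prod-++ a b)) (sym (∘ₚ-assoc (simple s) (prod a) (prod b)))

  ℓ-∘ₚ-prod-≤ : (x : Perm n) (w : Word n) → ℓ (x ∘ₚ prod w) ℕ.≤ ℓ x + length w
  ℓ-∘ₚ-prod-≤ x []      = ℕ.≤-reflexive (trans (cong ℓ (∘ₚ-identityʳ x)) (sym (ℕ.+-identityʳ (ℓ x))))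
  ℓ-∘ₚ-prod-≤ x (s ∷ w) = begin
    ℓ (x ∘ₚ (simple s ∘ₚ prod w)) ≡⟨ cong ℓ (∘ₚ-assoc x (simple s) (prod w)) ⟨
    ℓ ((x ∘ₚ simple s) ∘ₚ prod w) ≤⟨ ℓ-∘ₚ-prod-≤ (x ∘ₚ simple s) w ⟩
    ℓ (x ∘ₚ simple s) + length w  ≤⟨ ℕ.+-monoˡ-≤ (length w) (ℓ-∘ₚ-simple-≤ x s) ⟩
    suc (ℓ x) + length w          ≡⟨ ℕ.+-suc (ℓ x) (length w) ⟨
    ℓ x + suc (length w)          ∎
    where open ℕ.≤-Reasoning

  InTL-mono-≤R : {ρ π : Perm n} → ρ ≤R π → (t : Label n) → InTL t ρ → InTL t π
  InTL-mono-≤R {ρ} {π} (a , b , (prod-a , ℓ-a) , (prod-ab , ℓ-ab)) t (t-refl , tρ<ρ) = t-refl , (begin-strict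
    ℓ (toPerm t ∘ₚ π)             ≡⟨ cong (λ w → ℓ (toPerm t ∘ₚ w)) π≡ρ∘ₚb ⟩
    ℓ (toPerm t ∘ₚ (ρ ∘ₚ prod b)) ≡⟨ cong ℓ (∘ₚ-assoc (toPerm t) ρ (prod b)) ⟨
    ℓ ((toPerm t ∘ₚ ρ) ∘ₚ prod b) ≤⟨ ℓ-∘ₚ-prod-≤ (toPerm t ∘ₚ ρ) b ⟩
    ℓ (toPerm t ∘ₚ ρ) + length b  <⟨ ℕ.+-monoˡ-< (length b) tρ<ρ ⟩
    ℓ ρ + length b                ≡⟨ cong (_+ length b) ℓ-a ⟨
    length a + length b           ≡⟨ trans (sym (length-++ a)) ℓ-ab ⟩
    ℓ π                           ∎)
    where
    open ℕ.≤-Reasoning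
    π≡ρ∘ₚb : π ≡ ρ ∘ₚ prod b
    π≡ρ∘ₚb = trans (sym prod-ab) (trans (prod-++ a b) (cong (_∘ₚ prod b) prod-a))

  adjacent-increasing⇒≗id : (z : Fin n → Fin n) → (∀ {P Q} → Adjacent P Q → z P < z Q) → z ≗ id
  adjacent-increasing⇒≗id z increasing i = toℕ-injective (ℕ.≤-antisym z≤i (lowerBound (toℕ i) i refl))
    where
    lowerBound : ∀ k (i : Fin n) → toℕ i ≡ k → k ℕ.≤ toℕ (z i)
    lowerBound zero    i _   = z≤n
    lowerBound (suc k) i i≡1+k = ℕ.≤-<-trans (lowerBound k P (toℕ-fromℕ< k<n)) (increasing adj)
      where
      k<n : k ℕ.< n
      k<n = ℕ.<-trans (ℕ.n<1+n k) (subst (ℕ._< n) i≡1+k (toℕ<n i))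
      P : Fin n
      P = fromℕ< k<n
      adj : Adjacent P i
      adj = trans i≡1+k (cong suc (sym (toℕ-fromℕ< k<n)))
    upperBound : ∀ d (i : Fin n) → suc (d + toℕ i) ≡ n → suc (d + toℕ (z i)) ℕ.≤ n
    upperBound zero    i _   = toℕ<n (z i)
    upperBound (suc d) i gap = begin
      suc (suc d + toℕ (z i)) ≡⟨ cong suc (ℕ.+-suc d (toℕ (z i))) ⟨
      suc (d + suc (toℕ (z i))) ≤⟨ s≤s (ℕ.+-monoʳ-≤ d (increasing adj)) ⟩
      suc (d + toℕ (z Q))     ≤⟨ upperBound d Q gapQ ⟩
      n                       ∎
      where
      open ℕ.≤-Reasoning
      Q<n : suc (toℕ i) ℕ.< n
      Q<n = subst (suc (toℕ i) ℕ.<_) gap (s≤s (s≤s (ℕ.m≤n+m (toℕ i) d)))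
      Q : Fin n
      Q = fromℕ< Q<n
      adj : Adjacent i Q
      adj = toℕ-fromℕ< Q<n
      gapQ : suc (d + toℕ Q) ≡ n
      gapQ = trans (cong (λ w → suc (d + w)) adj) (trans (cong suc (ℕ.+-suc d (toℕ i))) gap)
    z≤i : toℕ (z i) ℕ.≤ toℕ i
    z≤i = ℕ.+-cancelˡ-≤ d _ _ (ℕ.≤-pred (ℕ.≤-trans (upperBound d i gap) (ℕ.≤-reflexive (sym gap))))
      where
      d : ℕ
      d = n ∸ suc (toℕ i)
      gap : suc (d + toℕ i) ≡ n
      gap = trans (sym (ℕ.+-suc d (toℕ i))) (ℕ.m∸n+n≡m (toℕ<n i))

module Extension {n : ℕ} (y : Perm n) (pos : Fin n → Fin n) (y∘pos : ∀ v → lookup y (pos v) ≡ v) where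

  -- Every inversion of x (a larger value before a smaller one) is an inversion of y.
  InversionsWithin : Perm n → Set
  InversionsWithin x = ∀ {i j} → i < j → lookup x j < lookup x i → pos (lookup x i) < pos (lookup x j)

  pos-injective : Injective _≡_ _≡_ pos
  pos-injective {u} {v} eq = trans (sym (y∘pos u)) (trans (cong (lookup y) eq) (y∘pos v))

  module Step (x : Perm n) (px : IsPerm x) (within : InversionsWithin x)
              {P Q : Fin n} (adj : Adjacent P Q) (descent : pos (lookup x Q) < pos (lookup x P)) where

    x′ : Perm n
    x′ = x ∘ₚ transp P Q

    ascent : lookup x P < lookup x Q
    ascent with <-cmp (lookup x P) (lookup x Q)
    ... | tri< xP<xQ _ _ = xP<xQ
    ... | tri≈ _ xP≡xQ _ = contradiction (px P Q xP≡xQ) (<⇒≢ (Adjacent⇒< adj))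
    ... | tri> _ _ xQ<xP = contradiction (within (Adjacent⇒< adj) xQ<xP) (<-asym descent)

    IsPerm-x′ : IsPerm x′
    IsPerm-x′ = IsPerm-∘ₚ x (transp P Q) px (IsPerm-transp P Q)

    ℓ-x′ : ℓ x′ ≡ suc (ℓ x)
    ℓ-x′ = begin
      ℓ x′                             ≡⟨ ℓ≡inversions x′ ⟩
      inversions (lookup x′)           ≡⟨ inversions-cong (lookup-∘ₚ-transp x P Q) ⟩
      inversions (lookup x ∘ swap P Q) ≡⟨ inversions-swap-ascent (lookup x) adj ascent ⟩
      suc (inversions (lookup x))      ≡⟨ cong suc (ℓ≡inversions x) ⟨
      suc (ℓ x)                        ∎
      where open ≡-Reasoning

    measure-x′ : inversions (pos ∘ lookup x) ≡ suc (inversions (pos ∘ lookup x′))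
    measure-x′ = trans (inversions-swap-descent (pos ∘ lookup x) adj descent)
                       (cong suc (inversions-cong (cong pos ∘ sym ∘ lookup-∘ₚ-transp x P Q)))

    within-x′ : InversionsWithin x′
    within-x′ {i} {j} i<j x′j<x′i = subst₂ (λ u v → pos u < pos v)
      (sym (lookup-∘ₚ-transp x P Q i)) (sym (lookup-∘ₚ-transp x P Q j)) (byCases (i Fin.≟ P) (j Fin.≟ Q))
      where
      xj<xi : lookup x (swap P Q j) < lookup x (swap P Q i)
      xj<xi = subst₂ _<_ (lookup-∘ₚ-transp x P Q j) (lookup-∘ₚ-transp x P Q i) x′j<x′i
      byCases : Dec (i ≡ P) → Dec (j ≡ Q) → pos (lookup x (swap P Q i)) < pos (lookup x (swap P Q j))
      byCases (yes refl) (yes refl) = subst₂ (λ u v → pos (lookup x u) < pos (lookup x v))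
                                        (sym (swap-first P Q)) (sym (swap-second P Q)) descent
      byCases (no i≢P) _        = within (swap-adjacent-<-preserved adj i<j (i≢P ∘ proj₁)) xj<xi
      byCases _        (no j≢Q) = within (swap-adjacent-<-preserved adj i<j (j≢Q ∘ proj₂)) xj<xi

  -- Greedy extension: at an adjacent descent of pos ∘ lookup x, multiplying x on the right by that
  -- simple reflection adds one more inversion of y; the measure inversions (pos ∘ lookup x)
  -- counts the inversions of y that x still lacks.
  adjacentDescent? : (z : Fin n → Fin n) → Dec (∃₂ λ P Q → Adjacent P Q × z Q < z P)
  adjacentDescent? z = any? λ P → any? λ Q → (toℕ Q ℕ.≟ suc (toℕ P)) ×-dec (z Q <? z P)

  extend : (x : Perm n) → IsPerm x → InversionsWithin x → Acc ℕ._<_ (inversions (pos ∘ lookup x)) →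
           (a : Word n) → IsReduced a x → Σ[ b ∈ Word n ] IsReduced (a ++ b) y
  extend x px within (acc rec) a (prod-a , ℓ-a) with adjacentDescent? (pos ∘ lookup x)
  ... | no noDescent =
    [] , subst (λ w → IsReduced w y) (sym (++-identityʳ a)) (trans prod-a x≡y , trans ℓ-a (cong ℓ x≡y))
    where
    increasing : ∀ {P Q} → Adjacent P Q → pos (lookup x P) < pos (lookup x Q)
    increasing {P} {Q} adj with <-cmp (pos (lookup x P)) (pos (lookup x Q))
    ... | tri< lt _ _ = lt
    ... | tri≈ _ eq _ = contradiction (px P Q (pos-injective eq)) (<⇒≢ (Adjacent⇒< adj))
    ... | tri> _ _ gt = contradiction (P , Q , adj , gt) noDescent
    x≡y : x ≡ y
    x≡y = Perm-ext λ i → trans (sym (y∘pos (lookup x i)))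
                               (cong (lookup y) (adjacent-increasing⇒≗id (pos ∘ lookup x) increasing i))
  ... | yes (P , Q , adj , descent) =
    s ∷ proj₁ rest , subst (λ w → IsReduced w y) (++-assoc a [ s ] (proj₁ rest)) (proj₂ rest)
    where
    open Step x px within adj descent
    s : SimpleIx n
    s = proj₁ (simple-at adj)
    reduced-x′ : IsReduced (a ++ [ s ]) x′
    reduced-x′ =
      trans (prod-++ a [ s ]) (cong₂ _∘ₚ_ prod-a (trans (∘ₚ-identityʳ (simple s)) (proj₂ (simple-at adj)))) ,
      trans (length-++ a) (trans (ℕ.+-comm (length a) 1) (trans (cong suc ℓ-a) (sym ℓ-x′)))
    rest : Σ[ b ∈ Word n ] IsReduced ((a ++ [ s ]) ++ b) y
    rest = extend x′ IsPerm-x′ within-x′ (rec (ℕ.≤-reflexive (sym measure-x′))) (a ++ [ s ]) reduced-x′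

injective⇒surjective : ∀ {n} (f : Fin n → Fin n) → Injective _≡_ _≡_ f → ∀ v → ∃ λ k → f k ≡ v
injective⇒surjective {suc m} f f-inj v with any? (λ k → f k ≟ v)
... | yes hit = hit
... | no miss = ⊥-elim (<⇒notInjective (ℕ.n<1+n m) punchOut∘f-injective)
  where
  v≢f : ∀ k → v ≢ f k
  v≢f k v≡fk = miss (k , sym v≡fk)
  punchOut∘f-injective : Injective _≡_ _≡_ (λ k → punchOut (v≢f k))
  punchOut∘f-injective eq = f-inj (punchOut-injective (v≢f _) (v≢f _) eq)

module _ {n : ℕ} (g : Fin n → Fin n) (g-inj : Injective _≡_ _≡_ g) where

  preimage : Fin n → Fin n
  preimage v = proj₁ (injective⇒surjective g g-inj v)

  g∘preimage : ∀ v → g (preimage v) ≡ v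
  g∘preimage v = proj₂ (injective⇒surjective g g-inj v)

  arrange : Perm n
  arrange = tabulate preimage

  lookup-arrange : ∀ v → lookup arrange (g v) ≡ v
  lookup-arrange v = trans (lookup∘tabulate preimage (g v)) (g-inj (g∘preimage (g v)))

  IsPerm-arrange : IsPerm arrange
  IsPerm-arrange i j eq = begin
    i              ≡⟨ g∘preimage i ⟨
    g (preimage i) ≡⟨ cong g (trans (sym (lookup∘tabulate preimage i)) (trans eq (lookup∘tabulate preimage j))) ⟩
    g (preimage j) ≡⟨ g∘preimage j ⟩
    j              ∎
    where open ≡-Reasoning

module _ {n : ℕ} where

  reducedWord : (x : Perm n) → IsPerm x → Σ[ a ∈ Word n ] IsReduced a x
  reducedWord x px = extend e IsPerm-e noInversions (<-wellFounded _) [] (refl , sym (ℓ-e {n}))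
    where
    open Extension x (preimage (lookup x) (px _ _)) (g∘preimage (lookup x) (px _ _))
    noInversions : InversionsWithin e
    noInversions i<j ej<ei = contradiction (subst₂ _<_ (lookup-allFin _) (lookup-allFin _) ej<ei) (<-asym i<j)

  ≤R-fromInversions : (x y : Perm n) → IsPerm x →
                      (pos : Fin n → Fin n) (y∘pos : ∀ v → lookup y (pos v) ≡ v) →
                      Extension.InversionsWithin y pos y∘pos x → x ≤R y
  ≤R-fromInversions x y px pos y∘pos within =
    proj₁ word , proj₁ rest , proj₂ word , proj₂ rest
    where
    open Extension y pos y∘pos
    word : Σ[ a ∈ Word n ] IsReduced a x
    word = reducedWord x px
    rest : Σ[ b ∈ Word n ] IsReduced (proj₁ word ++ b) y
    rest = extend x px within (<-wellFounded _) (proj₁ word) (proj₂ word)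

module Ranking {n : ℕ} (key : Fin n → ℕ) where

  #smallerKeys : Fin n → ℕ
  #smallerKeys v = sum λ w → indic ⌊ key w ℕ.<? key v ⌋

  private
    not-smaller-than-self : ∀ v → indic ⌊ key v ℕ.<? key v ⌋ ≡ 0
    not-smaller-than-self v = cong indic (⌊⌋-false (key v ℕ.<? key v) (ℕ.<-irrefl refl))

  #smallerKeys<n : ∀ v → #smallerKeys v ℕ.< n
  #smallerKeys<n v = subst (#smallerKeys v ℕ.<_) (sum-ones n)
    (sum-mono-< (λ w → indic≤1 _) v (subst (ℕ._< 1) (sym (not-smaller-than-self v)) (s≤s z≤n)))

  #smallerKeys-mono : ∀ {u v} → key u ℕ.< key v → #smallerKeys u ℕ.< #smallerKeys v
  #smallerKeys-mono {u} {v} ku<kv = sum-mono-< pointwise u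
    (subst₂ ℕ._<_ (sym (not-smaller-than-self u)) (sym (cong indic (⌊⌋-true (key u ℕ.<? key v) ku<kv))) (s≤s z≤n))
    where
    pointwise : ∀ w → indic ⌊ key w ℕ.<? key u ⌋ ℕ.≤ indic ⌊ key w ℕ.<? key v ⌋
    pointwise w with key w ℕ.<? key u
    ... | no _      = z≤n
    ... | yes kw<ku = ℕ.≤-reflexive (sym (cong indic (⌊⌋-true (key w ℕ.<? key v) (ℕ.<-trans kw<ku ku<kv))))

  rank : Fin n → Fin n
  rank v = fromℕ< (#smallerKeys<n v)

  rank-mono : ∀ {u v} → key u ℕ.< key v → rank u < rank v
  rank-mono ku<kv = subst₂ ℕ._<_ (sym (toℕ-fromℕ< _)) (sym (toℕ-fromℕ< _)) (#smallerKeys-mono ku<kv)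

  rank-injective : Injective _≡_ _≡_ key → Injective _≡_ _≡_ rank
  rank-injective key-inj {u} {v} eq with ℕ.<-cmp (key u) (key v)
  ... | tri< ku<kv _ _ = contradiction eq (<⇒≢ (rank-mono ku<kv))
  ... | tri≈ _ ku≡kv _ = key-inj ku≡kv
  ... | tri> _ _ kv<ku = contradiction (sym eq) (<⇒≢ (rank-mono kv<ku))

-- Chains of left inversions

module Chains {n : ℕ} (σ τ : Perm n) where

  Edge : Fin n → Fin n → Set
  Edge u v = InTL (u , v) σ ⊎ InTL (u , v) τ

  Chain : Fin n → Fin n → Set
  Chain = TransClosure Edge

  Edge⇒< : ∀ {u v} → Edge u v → u < v
  Edge⇒< (inj₁ uv∈σ) = proj₁ uv∈σ
  Edge⇒< (inj₂ uv∈τ) = proj₁ uv∈τ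

  Chain⇒< : ∀ {u v} → Chain u v → u < v
  Chain⇒< [ edge ]⁺   = Edge⇒< edge
  Chain⇒< (edge ∷ ch) = <-trans (Edge⇒< edge) (Chain⇒< ch)

  InTL? : (t : Label n) (x : Perm n) → Dec (InTL t x)
  InTL? (u , v) x = (u <? v) ×-dec (ℓ (transp u v ∘ₚ x) ℕ.<? ℓ x)

  edge? : ∀ u v → Dec (Edge u v)
  edge? u v = InTL? (u , v) σ ⊎-dec InTL? (u , v) τ

  chain? : ∀ u v → Dec (Chain u v)
  chain? u v = from u (>-wellFounded u)
    where
    from : ∀ u → Acc _>_ u → Dec (Chain u v)
    from u (acc rec) = map′ join split (edge? u v ⊎-dec any? viaEdge)
      where
      viaEdge : ∀ w → Dec (Edge u w × Chain w v)
      viaEdge w with edge? u w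
      ... | no ¬edge = no (¬edge ∘ proj₁)
      ... | yes edge = map′ (edge ,_) proj₂ (from w (rec (Edge⇒< edge)))
      join : Edge u v ⊎ ∃ (λ w → Edge u w × Chain w v) → Chain u v
      join (inj₁ edge)            = [ edge ]⁺
      join (inj₂ (_ , edge , ch)) = edge ∷ ch
      split : Chain u v → Edge u v ⊎ ∃ (λ w → Edge u w × Chain w v)
      split [ edge ]⁺   = inj₁ edge
      split (edge ∷ ch) = inj₂ (_ , edge , ch)

  module Separation (pσ : IsPerm σ) (pτ : IsPerm τ) {a c : Fin n} (a<c : a < c) (noChain : ¬ Chain a c) where

    Reaches : Fin n → Set
    Reaches v = Chain v c ⊎ v ≡ c

    reaches? : ∀ v → Dec (Reaches v)
    reaches? v = chain? v c ⊎-dec (v ≟ c)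

    reaches-back : ∀ {u v} → Edge u v → Reaches v → Reaches u
    reaches-back edge (inj₁ ch)   = inj₁ (edge ∷ ch)
    reaches-back edge (inj₂ refl) = inj₁ [ edge ]⁺

    opp : Fin n → ℕ
    opp v = n ∸ suc (toℕ v)

    opp<n : ∀ v → opp v ℕ.< n
    opp<n v = ℕ.∸-monoʳ-< (s≤s z≤n) (toℕ<n v)

    opp-reverses : ∀ {u v} → u < v → opp v ℕ.< opp u
    opp-reverses u<v = ℕ.∸-monoʳ-< (s≤s u<v) (toℕ<n _)

    opp-injective : ∀ {u v} → opp u ≡ opp v → u ≡ v
    opp-injective eq = toℕ-injective (ℕ.suc-injective (ℕ.∸-cancelˡ-≡ (toℕ<n _) (toℕ<n _) eq))

    below-level : ∀ {x} y → x ℕ.< n → x ℕ.< n + y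
    below-level y x<n = ℕ.<-≤-trans x<n (ℕ.m≤m+n _ y)

    level : ∀ {v} → Dec (Reaches v) → ℕ
    level (yes _) = n
    level (no _)  = 0

    -- Ordering values by key: first those not reaching c, then those reaching c,
    -- each group in decreasing order.
    key : Fin n → ℕ
    key v = level (reaches? v) + opp v

    key-edge : ∀ {u v} → Edge u v → key v ℕ.< key u
    key-edge {u} {v} edge = compare (reaches? u) (reaches? v)
      where
      compare : (du : Dec (Reaches u)) (dv : Dec (Reaches v)) → level dv + opp v ℕ.< level du + opp u
      compare (yes _)  (yes _)  = ℕ.+-monoʳ-< n (opp-reverses (Edge⇒< edge))
      compare (no _)   (no _)   = opp-reverses (Edge⇒< edge)
      compare (yes _)  (no _)   = below-level (opp u) (opp<n v)
      compare (no ¬ru) (yes rv) = contradiction (reaches-back edge rv) ¬ru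

    key-a<key-c : key a ℕ.< key c
    key-a<key-c = compare (reaches? a) (reaches? c)
      where
      compare : (da : Dec (Reaches a)) (dc : Dec (Reaches c)) → level da + opp a ℕ.< level dc + opp c
      compare (yes (inj₁ ch))  _        = contradiction ch noChain
      compare (yes (inj₂ a≡c)) _        = contradiction a≡c (<⇒≢ a<c)
      compare (no _)           (yes _)  = below-level (opp c) (opp<n a)
      compare (no _)           (no ¬rc) = contradiction (inj₂ refl) ¬rc

    key-injective : Injective _≡_ _≡_ key
    key-injective {u} {v} = compare (reaches? u) (reaches? v)
      where
      compare : (du : Dec (Reaches u)) (dv : Dec (Reaches v)) → level du + opp u ≡ level dv + opp v → u ≡ v
      compare (yes _) (yes _) eq = opp-injective (ℕ.+-cancelˡ-≡ n _ _ eq)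
      compare (no _)  (no _)  eq = opp-injective eq
      compare (yes _) (no _)  eq = contradiction (ℕ.m≤m+n n (opp u)) (ℕ.<⇒≱ (subst (ℕ._< n) (sym eq) (opp<n v)))
      compare (no _)  (yes _) eq = contradiction (ℕ.m≤m+n n (opp v)) (ℕ.<⇒≱ (subst (ℕ._< n) eq (opp<n u)))

    open Ranking key

    π : Perm n
    π = arrange rank (rank-injective key-injective)

    π∘rank : ∀ v → lookup π (rank v) ≡ v
    π∘rank = lookup-arrange rank (rank-injective key-injective)

    IsPerm-π : IsPerm π
    IsPerm-π = IsPerm-arrange rank (rank-injective key-injective)

    edges≤R-π : (x : Perm n) → IsPerm x → (∀ {u v} → InTL (u , v) x → Edge u v) → x ≤R π
    edges≤R-π x px edge = ≤R-fromInversions x π px rank π∘rank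
      λ i<j xj<xi → rank-mono (key-edge (edge (inversion⇒InTL x px i<j xj<xi)))

    ac∉TL-π : ¬ InTL (a , c) π
    ac∉TL-π (_ , shorter) =
      ℕ.<-asym shorter (ℓ-transp∘ₚ-< π IsPerm-π (rank-mono key-a<key-c) (π∘rank a) (π∘rank c) a<c)

  InTL-join⇒Chain : IsPerm σ → IsPerm τ → ∀ {ρ} → IsJoinR σ τ ρ → ∀ {a c} → InTL (a , c) ρ → Chain a c
  InTL-join⇒Chain pσ pτ {ρ} (_ , _ , _ , least) {a} {c} ac∈TL-ρ with chain? a c
  ... | yes ch     = ch
  ... | no noChain = contradiction (InTL-mono-≤R ρ≤R-π (a , c) ac∈TL-ρ) ac∉TL-π
    where
    open Separation pσ pτ (proj₁ ac∈TL-ρ) noChain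
    ρ≤R-π : ρ ≤R π
    ρ≤R-π = least π IsPerm-π (edges≤R-π σ pσ inj₁) (edges≤R-π τ pτ inj₂)

-- Palindromic Bruhat paths

Palindrome-wrap : ∀ {A : Set} (x : A) {xs : List A} → Palindrome xs → Palindrome (x ∷ (xs ++ [ x ]))
Palindrome-wrap x {xs} pal = begin
  reverse (x ∷ (xs ++ [ x ]))   ≡⟨ unfold-reverse x (xs ++ [ x ]) ⟩
  reverse (xs ++ [ x ]) ∷ʳ x    ≡⟨ cong (_∷ʳ x) (reverse-++ xs [ x ]) ⟩
  x ∷ (reverse xs ∷ʳ x)         ≡⟨ cong (λ ys → x ∷ (ys ∷ʳ x)) pal ⟩
  x ∷ (xs ++ [ x ])             ∎
  where open ≡-Reasoning

last∈vertices : ∀ {n} {σ τ x y : Perm n} {ts} (p : BPath σ τ x ts y) → y ∈ vertices p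
last∈vertices done                = here refl
last∈vertices (step _ _ _ _ rest) = there (last∈vertices rest)

module _ {n : ℕ} where

  transp-conjugate : {a b c : Fin n} → a < b → b < c → transp a b ∘ₚ (transp b c ∘ₚ transp a b) ≡ transp a c
  transp-conjugate {a} {b} {c} a<b b<c = Perm-ext λ k → begin
    lookup (transp a b ∘ₚ (transp b c ∘ₚ transp a b)) k
      ≡⟨ lookup-∘ₚ (transp a b) (transp b c ∘ₚ transp a b) k ⟩
    lookup (transp a b) (lookup (transp b c ∘ₚ transp a b) k)
      ≡⟨ trans (lookup-transp a b _) (cong (swap a b) (lookup-∘ₚ (transp b c) (transp a b) k)) ⟩
    swap a b (lookup (transp b c) (lookup (transp a b) k))
      ≡⟨ cong (swap a b) (trans (lookup-transp b c _) (cong (swap b c) (lookup-transp a b k))) ⟩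
    swap a b (swap b c (swap a b k))
      ≡⟨ swap-conjugate a b c (<⇒≢ a<b) (<⇒≢ b<c) (<⇒≢ (<-trans a<b b<c)) k ⟩
    swap a c k
      ≡⟨ lookup-transp a c k ⟨
    lookup (transp a c) k ∎
    where open ≡-Reasoning

module Paths {n : ℕ} (σ τ : Perm n) where
  open Chains σ τ

  -- Each step exchanges values p < q standing at positions P < Q of the current vertex,
  -- which certifies that the length goes up; all these positions are at least lo.
  data PositionedPath (lo : Fin n) : Perm n → List (Label n) → Perm n → Set where
    done : ∀ {x} → PositionedPath lo x [] x
    step : ∀ {x ts y} {p q P Q : Fin n} → Edge p q → lo ≤ P → P < Q → lookup x P ≡ p → lookup x Q ≡ q →
           PositionedPath lo (transp p q ∘ₚ x) ts y → PositionedPath lo x ((p , q) ∷ ts) y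

  toBPath : ∀ {lo x ts y} → IsPerm x → PositionedPath lo x ts y → BPath σ τ x ts y
  toBPath px done = done
  toBPath {x = x} px (step {p = p} {q} edge _ P<Q xP xQ rest) =
    step (p , q) (Edge⇒< edge) edge (ℓ-transp∘ₚ-< x px P<Q xP xQ (Edge⇒< edge))
         (toBPath (IsPerm-∘ₚ (transp p q) x (IsPerm-transp p q) px) rest)

  snoc : ∀ {lo x ts y} {p q P Q : Fin n} → PositionedPath lo x ts y →
         Edge p q → lo ≤ P → P < Q → lookup y P ≡ p → lookup y Q ≡ q →
         PositionedPath lo x (ts ++ [ (p , q) ]) (transp p q ∘ₚ y)
  snoc done                          edge lo≤P P<Q yP yQ = step edge lo≤P P<Q yP yQ done
  snoc (step edge′ lo≤P′ P′<Q′ xP′ xQ′ rest) edge lo≤P P<Q yP yQ =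
    step edge′ lo≤P′ P′<Q′ xP′ xQ′ (snoc rest edge lo≤P P<Q yP yQ)

  swap-position : {a b P Q : Fin n} → a < b → b ≤ P → P < Q → a ≤ swap a b P × swap a b P < Q
  swap-position {a} {b} {P} {Q} a<b b≤P P<Q with swapCase a b P
  ... | first refl        = contradiction b≤P (ℕ.<⇒≱ a<b)
  ... | second _ refl     = subst (λ z → a ≤ z × z < Q) (sym (swap-second a b)) (≤-refl , <-trans a<b P<Q)
  ... | neither P≢a P≢b  = subst (λ z → a ≤ z × z < Q) (sym (swap-neither a b P P≢a P≢b))
                                  (ℕ.<⇒≤ (ℕ.<-≤-trans a<b b≤P) , P<Q)

  -- Right multiplication by (a b) only moves the positions a < b, so every step of a path whose
  -- positions are all ≥ b stays valid, with the bound lowered to a.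
  shift : ∀ {a b x ts y} → a < b → PositionedPath b x ts y →
          PositionedPath a (x ∘ₚ transp a b) ts (y ∘ₚ transp a b)
  shift a<b done = done
  shift {a} {b} a<b (step {x = x} {p = p} {q} {P} {Q} edge b≤P P<Q xP xQ rest) =
    step edge (proj₁ moved) (proj₂ moved) x′P′ x′Q
         (subst (λ z → PositionedPath a z _ _) (∘ₚ-assoc (transp p q) x (transp a b)) (shift a<b rest))
    where
    moved : a ≤ swap a b P × swap a b P < Q
    moved = swap-position a<b b≤P P<Q
    Q≢a : Q ≢ a
    Q≢a = <⇒≢ (ℕ.<-≤-trans a<b (ℕ.<⇒≤ (ℕ.≤-<-trans b≤P P<Q))) ∘ sym
    Q≢b : Q ≢ b
    Q≢b = <⇒≢ (ℕ.≤-<-trans b≤P P<Q) ∘ sym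
    x′P′ : lookup (x ∘ₚ transp a b) (swap a b P) ≡ p
    x′P′ = trans (lookup-∘ₚ-transp x a b _) (trans (cong (lookup x) (swap-involutive a b P)) xP)
    x′Q : lookup (x ∘ₚ transp a b) Q ≡ q
    x′Q = trans (lookup-∘ₚ-transp x a b Q) (trans (cong (lookup x) (swap-neither a b Q Q≢a Q≢b)) xQ)

  -- (a c) = (a b)(b c)(a b): wrap the path to (b c), shifted by (a b), between two (a b)-steps.
  palindromicPath : ∀ {a c} → Chain a c →
                    Σ[ ts ∈ List (Label n) ] PositionedPath a e ts (transp a c) × Palindrome ts
  palindromicPath {a} {c} [ edge ]⁺ =
    [ (a , c) ] ,
    subst (PositionedPath a e _) (∘ₚ-identityʳ (transp a c))
          (step edge ≤-refl (Edge⇒< edge) (lookup-allFin a) (lookup-allFin c) done) ,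
    refl
  palindromicPath {a} {c} (_∷_ {y = b} edge ch) =
    (a , b) ∷ (ts ++ [ (a , b) ]) , path , Palindrome-wrap (a , b) (proj₂ (proj₂ inner))
    where
    inner : Σ[ ts ∈ List (Label n) ] PositionedPath b e ts (transp b c) × Palindrome ts
    inner = palindromicPath ch
    ts : List (Label n)
    ts = proj₁ inner
    a<b : a < b
    a<b = Edge⇒< edge
    b<c : b < c
    b<c = Chain⇒< ch
    y : Perm n
    y = transp b c ∘ₚ transp a b
    shifted : PositionedPath a (transp a b ∘ₚ e) ts y
    shifted = subst (λ x → PositionedPath a x ts y)
                    (trans (∘ₚ-identityˡ (transp a b)) (sym (∘ₚ-identityʳ (transp a b))))
                    (shift a<b (proj₁ (proj₂ inner)))
    yb : lookup y b ≡ a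
    yb = trans (lookup-∘ₚ (transp b c) (transp a b) b)
         (trans (lookup-transp b c _) (trans (cong (swap b c) (trans (lookup-transp a b b) (swap-second a b)))
                (swap-neither b c a (<⇒≢ a<b) (<⇒≢ (<-trans a<b b<c)))))
    yc : lookup y c ≡ b
    yc = trans (lookup-∘ₚ (transp b c) (transp a b) c)
         (trans (lookup-transp b c _) (trans (cong (swap b c) (trans (lookup-transp a b c)
                (swap-neither a b c (<⇒≢ (<-trans a<b b<c) ∘ sym) (<⇒≢ b<c ∘ sym)))) (swap-second b c)))
    path : PositionedPath a e ((a , b) ∷ (ts ++ [ (a , b) ])) (transp a c)
    path = step edge ≤-refl a<b (lookup-allFin a) (lookup-allFin b)
             (subst (PositionedPath a _ _) (transp-conjugate a<b b<c)
                    (snoc shifted edge (ℕ.<⇒≤ a<b) b<c yb yc))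

mainTheorem3 : ∀ (n : ℕ) (σ τ ρ : Perm n) → IsPerm σ → IsPerm τ →
    IsJoinR σ τ ρ →
    ∀ (t : Label n) → InTL t ρ →
      (IsRefl t × InV σ τ (toPerm t)) ×
      (Σ[ ts ∈ List (Label n) ] Σ (BPath σ τ e ts (toPerm t)) (λ _ → Palindrome ts))
mainTheorem3 n σ τ ρ pσ pτ join (a , c) ac∈TL-ρ =
  (proj₁ ac∈TL-ρ , transp a c , ts , path , last∈vertices path) , ts , path , palindrome
  where
  open Chains σ τ
  open Paths σ τ
  witness : Σ[ ts ∈ List (Label n) ] PositionedPath a e ts (transp a c) × Palindrome ts
  witness = palindromicPath (InTL-join⇒Chain pσ pτ join ac∈TL-ρ)
  ts : List (Label n)
  ts = proj₁ witness
  path : BPath σ τ e ts (transp a c)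
  path = toBPath IsPerm-e (proj₁ (proj₂ witness))
  palindrome : Palindrome ts
  palindrome = proj₂ (proj₂ witness)
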